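{- Let $d\in\{1,2,3,7,11\}$. Suppose that $R_1\to R_2$ is an edge of $\mathcal{E}_d$ and that $R_1$ lies in the interior of $W_d\times\mathbb{R}_{>0}$. Then $R_2$ lies in the closure of $W_d\times\mathbb{R}_{>0}$.
   Context: $\omega_d=\sqrt{ -d}$ for $d\in\{1,2\}$, $\omega_d=\frac{1+\sqrt{ -d}}2$ for $d\in\{3,7,11\}$. The Farey graph $\mathcal{E}_d$ has vertex set $\mathbb{Q}(\sqrt{ -d})\cup\{\infty\}$ and edges $A(\infty)\to A(0)$, $A\in\mathrm{PSL}(2,\mathbb{Z}[\omega_d])$ acting by Möbius transformations. $W_d\subset\mathbb{C}$ is the rectangle with corners $0,1,\omega_d,\omega_d+1$ if $d\in\{1,2\}$ and the triangle with corners $0,1,\omega_d$ if $d\in\{3,7,11\}$. Vertices $z\in\mathbb{C}$ are regarded as boundary points $(z,0)$ of $\mathbb{H}^3=\mathbb{C}\times\mathbb{R}_{>0}$, and interior and closure are taken in $\mathbb{C}\times[0,\infty)$. -}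

module Defs where

open import Data.Integer using (ℤ)
open import Data.Rational using (ℚ; _+_; _*_; _≤_; _<_; _/_; 0ℚ; 1ℚ; -_)
open import Data.Product using (_×_; _,_; Σ; ∃-syntax)
open import Data.Empty using (⊥)
open import Relation.Binary.PropositionalEquality using (_≡_)

data D : Set where
  d1 d2 d3 d7 d11 : D

-- ω_d² = p_d · ω_d + q_d :
--   d ∈ {1,2}:    ω = √-d,        ω² = -d
--   d ∈ {3,7,11}: ω = (1+√-d)/2,  ω² = ω - (1+d)/4
ωp : D → ℚ
ωp d1 = 0ℚ
ωp d2 = 0ℚ
ωp d3 = 1ℚ
ωp d7 = 1ℚ
ωp d11 = 1ℚ

ωq : D → ℚ
ωq d1 = - (Data.Integer.+ 1 / 1)
ωq d2 = - (Data.Integer.+ 2 / 1)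
ωq d3 = - (Data.Integer.+ 1 / 1)
ωq d7 = - (Data.Integer.+ 2 / 1)
ωq d11 = - (Data.Integer.+ 3 / 1)

-- An element s + t·ω_d of ℚ(√-d), stored as its coordinates (s , t)
-- in the ℚ-basis (1 , ω_d).
K : Set
K = ℚ × ℚ

kzero kone : K
kzero = 0ℚ , 0ℚ
kone  = 1ℚ , 0ℚ

kadd : K → K → K
kadd (s₁ , t₁) (s₂ , t₂) = s₁ + s₂ , t₁ + t₂

kneg : K → K
kneg (s , t) = - s , - t

kmul : D → K → K → K
kmul d (s₁ , t₁) (s₂ , t₂) =
  (s₁ * s₂ + ωq d * (t₁ * t₂)) , (s₁ * t₂ + t₁ * s₂ + ωp d * (t₁ * t₂))

Zω : Set
Zω = ℤ × ℤ

ι : Zω → K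
ι (m , n) = (m / 1) , (n / 1)

-- A 2×2 matrix (a b ; c e) over ℤ[ω_d] with determinant 1, i.e. an
-- element of SL(2, ℤ[ω_d]) (representing an element of PSL(2, ℤ[ω_d])).
record SL2 (d : D) : Set where
  constructor mat
  field
    a b c e : Zω
    det1 : kadd (kmul d (ι a) (ι e)) (kneg (kmul d (ι b) (ι c))) ≡ kone
open SL2 public

data Vertex : Set where
  ∞   : Vertex
  fin : K → Vertex

-- Möbius action: A(v) = (a v + b)/(c v + e).  We only need the images
-- of ∞ and 0:  A(∞) = a/c (= ∞ iff c = 0),  A(0) = b/e (= ∞ iff e = 0).
-- "z = x / y" for y ≠ 0 is expressed as y·z = x.
_≈quot_/_ : {d : D} → Vertex → Zω → Zω → Set
_≈quot_/_ {d} ∞       x y = ι y ≡ kzero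
_≈quot_/_ {d} (fin z) x y = (ι y ≡ kzero → ⊥) × (kmul d (ι y) z ≡ ι x)

imgInf : (d : D) → SL2 d → Vertex → Set
imgInf d A v = _≈quot_/_ {d} v (a A) (c A)

imgZero : (d : D) → SL2 d → Vertex → Set
imgZero d A v = _≈quot_/_ {d} v (b A) (e A)

Edge : (d : D) → Vertex → Vertex → Set
Edge d R₁ R₂ = Σ (SL2 d) λ A → imgInf d A R₁ × imgZero d A R₂

-- W_d in ω-coordinates z = s + t ω_d:
--   d ∈ {1,2}: rectangle with corners 0,1,ω,ω+1  : 0 ≤ s ≤ 1, 0 ≤ t ≤ 1
--   d ∈ {3,7,11}: triangle with corners 0,1,ω    : 0 ≤ s, 0 ≤ t, s + t ≤ 1
-- Closed region and its (planar) interior.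
inWclosed : D → K → Set
inWclosed d1 (s , t) = (0ℚ ≤ s × s ≤ 1ℚ) × (0ℚ ≤ t × t ≤ 1ℚ)
inWclosed d2 (s , t) = (0ℚ ≤ s × s ≤ 1ℚ) × (0ℚ ≤ t × t ≤ 1ℚ)
inWclosed d3 (s , t) = 0ℚ ≤ s × 0ℚ ≤ t × s + t ≤ 1ℚ
inWclosed d7 (s , t) = 0ℚ ≤ s × 0ℚ ≤ t × s + t ≤ 1ℚ
inWclosed d11 (s , t) = 0ℚ ≤ s × 0ℚ ≤ t × s + t ≤ 1ℚ

inWopen : D → K → Set
inWopen d1 (s , t) = (0ℚ < s × s < 1ℚ) × (0ℚ < t × t < 1ℚ)
inWopen d2 (s , t) = (0ℚ < s × s < 1ℚ) × (0ℚ < t × t < 1ℚ)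
inWopen d3 (s , t) = 0ℚ < s × 0ℚ < t × s + t < 1ℚ
inWopen d7 (s , t) = 0ℚ < s × 0ℚ < t × s + t < 1ℚ
inWopen d11 (s , t) = 0ℚ < s × 0ℚ < t × s + t < 1ℚ

-- A vertex (as the boundary point (z,0)) lies in the interior /
-- closure of W_d × ℝ_{>0} (taken in ℂ × [0,∞)) iff it is finite and
-- z lies in the interior / closure of W_d.  ∞ lies in neither.
InInterior : D → Vertex → Set
InInterior d ∞ = ⊥
InInterior d (fin z) = inWopen d z

InClosure : D → Vertex → Set
InClosure d ∞ = ⊥
InClosure d (fin z) = inWclosed d z

module Submission where

-- Write the edge as A(∞) → A(0) with A = (a b ; c e), so R₁ = a/c, R₂ = b/e and
-- ae − bc = 1.  Take a line through u ∈ ℤ[ω] with direction l ∈ ℤ[ω].  The heights of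
-- R₁ and R₂ above it, rescaled by N(c) and N(e), are integers X and Y, and
--   N(l̄(a − uc)ē − lc·conj(b − ue)) = disc·X·Y + N(l)·N(ae − bc),   disc = −(p² + 4q).
-- If N(l) < disc this forces X·Y > −1, so X > 0 implies Y ≥ 0: an edge starting
-- strictly on one side of such a line ends on its closed side.  The sides of W_d are
-- lines of this kind.  If R₂ = ∞ then e = 0, so c is a unit and R₁ is a lattice
-- point, and no lattice point lies in the interior of W_d.

open import Defs
open import Algebra.Bundles.Raw using (RawRing)
open import Data.Empty using (⊥)
open import Data.Integer as ℤ using (ℤ; +_; -[1+_]; +[1+_]; 0ℤ; 1ℤ; -1ℤ; +<+; +≤+; -≤-)
import Data.Integer.Properties as ℤ
import Data.Integer.Solver as ℤSolver
open import Data.Nat as ℕ using (ℕ)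
import Data.Nat.Coprimality as ℕ
import Data.Nat.Properties as ℕ
open import Data.Product using (_×_; _,_; proj₁; proj₂; uncurry)
open import Data.Rational as ℚ using (ℚ; 0ℚ; 1ℚ; mkℚ; _/_; *<*; *≤*)
import Data.Rational.Properties as ℚ
import Data.Rational.Solver as ℚSolver
open import Function using (_∘_)
open import Relation.Nullary using (¬_; yes; no; contradiction)
open import Relation.Nullary.Decidable using (True; toWitness)
open import Relation.Binary.PropositionalEquality

-- (x₀ , x₁) stands for x₀ + x₁ω with ω² = pω + q, as in kmul.
-- Over ℤ[ω_d], side l a c is a positive multiple of Im(l̄ · a/c): it is positive
-- exactly when a/c lies to the left of the line ℝl.
module Quadratic {c ℓ} (R : RawRing c ℓ) (p q : RawRing.Carrier R) where
  open RawRing R public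

  infixl 7 _·_
  infixl 6 _−_

  _·_ : Carrier × Carrier → Carrier × Carrier → Carrier × Carrier
  (x₀ , x₁) · (y₀ , y₁) = x₀ * y₀ + q * (x₁ * y₁) , x₀ * y₁ + x₁ * y₀ + p * (x₁ * y₁)

  _−_ : Carrier × Carrier → Carrier × Carrier → Carrier × Carrier
  (x₀ , x₁) − (y₀ , y₁) = x₀ + - y₀ , x₁ + - y₁

  conj : Carrier × Carrier → Carrier × Carrier
  conj (x₀ , x₁) = x₀ + p * x₁ , - x₁

  norm : Carrier × Carrier → Carrier
  norm x = proj₁ (x · conj x)

  disc : Carrier
  disc = - (q + q + q + q) + - (p * p)

  side : Carrier × Carrier → Carrier × Carrier → Carrier × Carrier → Carrier
  side l x y = proj₂ (conj l · x · conj y)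

data Wall : Set where
  left bottom right top diagonal : Wall

-- Wall W is the line basepoint W + ℝ · direction W, with W_d on its left.  The open
-- half-plane is lower W < upper W, where the forms are evaluated in homogeneous
-- coordinates: at (z , 1) they are the inequalities of inWopen, at (a c̄ , N(c))
-- they are those for z = a/c multiplied by N(c).
module Walls {c ℓ} (R : RawRing c ℓ) where
  open RawRing R

  direction basepoint : Wall → Carrier × Carrier
  direction left     = 0# , - 1#
  direction bottom   = 1# , 0#
  direction right    = 0# , 1#
  direction top      = - 1# , 0#
  direction diagonal = - 1# , 1#
  basepoint left     = 0# , 0#
  basepoint bottom   = 0# , 0#
  basepoint right    = 1# , 0#
  basepoint top      = 0# , 1#
  basepoint diagonal = 1# , 0#

  lower upper : Wall → Carrier × Carrier → Carrier → Carrier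
  lower left     _         _ = 0#
  lower bottom   _         _ = 0#
  lower right    (x₀ , _)  _ = x₀
  lower top      (_ , x₁)  _ = x₁
  lower diagonal (x₀ , x₁) _ = x₀ + x₁
  upper left     (x₀ , _)  _ = x₀
  upper bottom   (_ , x₁)  _ = x₁
  upper right    _         h = h
  upper top      _         h = h
  upper diagonal _         h = h

module _ where
  open ℤSolver.+-*-Solver using (Polynomial; solve; _:=_; con; _:+_; _:*_; :-_)

  polynomials : ℕ → RawRing _ _
  polynomials n = record
    { Carrier = Polynomial n ; _≈_ = _≡_ ; _+_ = _:+_ ; _*_ = _:*_ ; -_ = :-_ ; 0# = con 0ℤ ; 1# = con 1ℤ }

  -- With z = a/c, w = b/e, Z = l̄z and W = l̄w, this is |Z − W̄|² − |Z − W|² = 4 Im Z Im W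
  -- multiplied by |ce|².
  norm-crossing : ∀ p q l a b c e → let open Quadratic ℤ.+-*-rawRing p q in
    norm (conj l · a · conj e − l · c · conj b) ≡ disc * (side l a c * side l b e) + norm l * norm (a · e − b · c)
  norm-crossing p q (l₀ , l₁) (a₀ , a₁) (b₀ , b₁) (c₀ , c₁) (e₀ , e₁) = solve 12
    (λ p q l₀ l₁ a₀ a₁ b₀ b₁ c₀ c₁ e₀ e₁ →
      let open Quadratic (polynomials 12) p q
          l = l₀ , l₁ ; a = a₀ , a₁ ; b = b₀ , b₁ ; c = c₀ , c₁ ; e = e₀ , e₁
      in norm (conj l · a · conj e − l · c · conj b) := disc * (side l a c * side l b e) + norm l * norm (a · e − b · c))
    refl p q l₀ l₁ a₀ a₁ b₀ b₁ c₀ c₁ e₀ e₁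

  det-translate : ∀ p q u a b c e → let open Quadratic ℤ.+-*-rawRing p q in
    (a − u · c) · e − (b − u · e) · c ≡ a · e − b · c
  det-translate p q (u₀ , u₁) (a₀ , a₁) (b₀ , b₁) (c₀ , c₁) (e₀ , e₁) = cong₂ _,_
    (solve 12 (λ p q u₀ u₁ a₀ a₁ b₀ b₁ c₀ c₁ e₀ e₁ →
      let open Quadratic (polynomials 12) p q
          u = u₀ , u₁ ; a = a₀ , a₁ ; b = b₀ , b₁ ; c = c₀ , c₁ ; e = e₀ , e₁
      in proj₁ ((a − u · c) · e − (b − u · e) · c) := proj₁ (a · e − b · c))
      refl p q u₀ u₁ a₀ a₁ b₀ b₁ c₀ c₁ e₀ e₁)
    (solve 12 (λ p q u₀ u₁ a₀ a₁ b₀ b₁ c₀ c₁ e₀ e₁ →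
      let open Quadratic (polynomials 12) p q
          u = u₀ , u₁ ; a = a₀ , a₁ ; b = b₀ , b₁ ; c = c₀ , c₁ ; e = e₀ , e₁
      in proj₂ ((a − u · c) · e − (b − u · e) · c) := proj₂ (a · e − b · c))
      refl p q u₀ u₁ a₀ a₁ b₀ b₁ c₀ c₁ e₀ e₁)

  wall-side-equation : Wall → ∀ {n} (p q a₀ a₁ c₀ c₁ : Polynomial n) → Polynomial n × Polynomial n
  wall-side-equation W p q a₀ a₁ c₀ c₁ =
    let open Quadratic (polynomials _) p q
        open Walls (polynomials _)
        a = a₀ , a₁ ; c = c₀ , c₁
    in side (direction W) (a − basepoint W · c) c , upper W (a · conj c) (norm c) + - lower W (a · conj c) (norm c)

  wall-side : ∀ W p q a c →
    let open Quadratic ℤ.+-*-rawRing p q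
        open Walls ℤ.+-*-rawRing
    in side (direction W) (a − basepoint W · c) c ≡ upper W (a · conj c) (norm c) + - lower W (a · conj c) (norm c)
  wall-side left     p q (a₀ , a₁) (c₀ , c₁) =
    solve 6 (λ p q a₀ a₁ c₀ c₁ → uncurry _:=_ (wall-side-equation left p q a₀ a₁ c₀ c₁))
      refl p q a₀ a₁ c₀ c₁
  wall-side bottom   p q (a₀ , a₁) (c₀ , c₁) =
    solve 6 (λ p q a₀ a₁ c₀ c₁ → uncurry _:=_ (wall-side-equation bottom p q a₀ a₁ c₀ c₁))
      refl p q a₀ a₁ c₀ c₁
  wall-side right    p q (a₀ , a₁) (c₀ , c₁) =
    solve 6 (λ p q a₀ a₁ c₀ c₁ → uncurry _:=_ (wall-side-equation right p q a₀ a₁ c₀ c₁))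
      refl p q a₀ a₁ c₀ c₁
  wall-side top      p q (a₀ , a₁) (c₀ , c₁) =
    solve 6 (λ p q a₀ a₁ c₀ c₁ → uncurry _:=_ (wall-side-equation top p q a₀ a₁ c₀ c₁))
      refl p q a₀ a₁ c₀ c₁
  wall-side diagonal p q (a₀ , a₁) (c₀ , c₁) =
    solve 6 (λ p q a₀ a₁ c₀ c₁ → uncurry _:=_ (wall-side-equation diagonal p q a₀ a₁ c₀ c₁))
      refl p q a₀ a₁ c₀ c₁

  norm*4 : ∀ p q x₀ x₁ → let open Quadratic ℤ.+-*-rawRing p q in
    norm (x₀ , x₁) * + 4 ≡ (x₀ + x₀ + p * x₁) * (x₀ + x₀ + p * x₁) + disc * (x₁ * x₁)
  norm*4 = solve 4 (λ p q x₀ x₁ → let open Quadratic (polynomials 4) p q in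
    norm (x₀ , x₁) * con (+ 4) := (x₀ + x₀ + p * x₁) * (x₀ + x₀ + p * x₁) + disc * (x₁ * x₁)) refl

  norm-rational : ∀ p q x₀ → let open Quadratic ℤ.+-*-rawRing p q in norm (x₀ , 0ℤ) ≡ x₀ * x₀
  norm-rational = solve 3 (λ p q x₀ → let open Quadratic (polynomials 3) p q in norm (x₀ , 0#) := x₀ * x₀) refl

  norm-antidiagonal-det : ∀ p q a b c → let open Quadratic ℤ.+-*-rawRing p q in
    norm (a · (0ℤ , 0ℤ) − b · c) ≡ norm b * norm c
  norm-antidiagonal-det p q (a₀ , a₁) (b₀ , b₁) (c₀ , c₁) = solve 8
    (λ p q a₀ a₁ b₀ b₁ c₀ c₁ →
      let open Quadratic (polynomials 8) p q
          a = a₀ , a₁ ; b = b₀ , b₁ ; c = c₀ , c₁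
      in norm (a · (0# , 0#) − b · c) := norm b * norm c)
    refl p q a₀ a₁ b₀ b₁ c₀ c₁

module _ where
  open ℚSolver.+-*-Solver using (Polynomial; solve; _:=_; con; _:+_; _:*_; :-_)

  ℚpolynomials : ℕ → RawRing _ _
  ℚpolynomials n = record
    { Carrier = Polynomial n ; _≈_ = _≡_ ; _+_ = _:+_ ; _*_ = _:*_ ; -_ = :-_ ; 0# = con 0ℚ ; 1# = con 1ℚ }

  ·-conj-norm : ∀ p q c z → let open Quadratic ℚ.+-*-rawRing p q in
    (c · z) · conj c ≡ (proj₁ z * norm c , proj₂ z * norm c)
  ·-conj-norm p q (c₀ , c₁) (s , t) = cong₂ _,_
    (solve 6 (λ p q c₀ c₁ s t → let open Quadratic (ℚpolynomials 6) p q ; c = c₀ , c₁ in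
      proj₁ ((c · (s , t)) · conj c) := s * norm c) refl p q c₀ c₁ s t)
    (solve 6 (λ p q c₀ c₁ s t → let open Quadratic (ℚpolynomials 6) p q ; c = c₀ , c₁ in
      proj₂ ((c · (s , t)) · conj c) := t * norm c) refl p q c₀ c₁ s t)

0≤i*i : ∀ i → 0ℤ ℤ.≤ i ℤ.* i
0≤i*i (+ 0)     = +≤+ ℕ.z≤n
0≤i*i +[1+ n ] = +≤+ ℕ.z≤n
0≤i*i -[1+ n ] = +≤+ ℕ.z≤n

0<i*i : ∀ {i} → i ≢ 0ℤ → 0ℤ ℤ.< i ℤ.* i
0<i*i {+ 0}       i≢0 = contradiction refl i≢0
0<i*i {+[1+ n ]}  _   = +<+ (ℕ.s≤s ℕ.z≤n)
0<i*i { -[1+ n ]} _   = +<+ (ℕ.s≤s ℕ.z≤n)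

0≤i⇒0≤j⇒0≤i*j : ∀ {i j} → 0ℤ ℤ.≤ i → 0ℤ ℤ.≤ j → 0ℤ ℤ.≤ i ℤ.* j
0≤i⇒0≤j⇒0≤i*j {i} 0≤i 0≤j =
  subst (ℤ._≤ i ℤ.* _) (ℤ.*-zeroʳ i) (ℤ.*-monoˡ-≤-nonNeg i {{ℤ.nonNegative 0≤i}} 0≤j)

0<i⇒0<j⇒0<i*j : ∀ {i j} → 0ℤ ℤ.< i → 0ℤ ℤ.< j → 0ℤ ℤ.< i ℤ.* j
0<i⇒0<j⇒0<i*j {i} 0<i 0<j =
  subst (ℤ._< i ℤ.* _) (ℤ.*-zeroʳ i) (ℤ.*-monoˡ-<-pos i {{ℤ.positive 0<i}} 0<j)

i<j⇒0<j-i : ∀ {i j} → i ℤ.< j → 0ℤ ℤ.< j ℤ.- i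
i<j⇒0<j-i {i} {j} i<j = subst (ℤ._< j ℤ.- i) (ℤ.+-inverseʳ i) (ℤ.+-monoˡ-< (ℤ.- i) i<j)

0≤i⇒0<j⇒i*j≡1⇒j≡1 : ∀ {i j} → 0ℤ ℤ.≤ i → 0ℤ ℤ.< j → i ℤ.* j ≡ 1ℤ → j ≡ 1ℤ
0≤i⇒0<j⇒i*j≡1⇒j≡1 {+ m} {+[1+ n ]} _ _ m*n≡1 =
  cong +_ (ℕ.m*n≡1⇒n≡1 m (ℕ.suc n) (ℤ.+-injective (trans (ℤ.pos-* m (ℕ.suc n)) m*n≡1)))
0≤i⇒0<j⇒i*j≡1⇒j≡1 {+ m} {+ 0} _ (+<+ ()) _

0≤d*[x*y]+k⇒0≤y : ∀ {d k x y} → 0ℤ ℤ.≤ d → k ℤ.< d → 0ℤ ℤ.< x →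
                  0ℤ ℤ.≤ d ℤ.* (x ℤ.* y) ℤ.+ k → 0ℤ ℤ.≤ y
0≤d*[x*y]+k⇒0≤y {y = + n} _ _ _ _ = +≤+ ℕ.z≤n
0≤d*[x*y]+k⇒0≤y {x = + 0} { -[1+ n ]} _ _ (+<+ ()) _
0≤d*[x*y]+k⇒0≤y {d} {k} {+[1+ m ]} { -[1+ n ]} 0≤d k<d _ 0≤h = contradiction 0≤h (ℤ.<⇒≱ h<0)
  where
  open ℤ.≤-Reasoning
  h<0 : d ℤ.* (+[1+ m ] ℤ.* -[1+ n ]) ℤ.+ k ℤ.< 0ℤ
  h<0 = begin-strict
    d ℤ.* (+[1+ m ] ℤ.* -[1+ n ]) ℤ.+ k
      ≤⟨ ℤ.+-monoˡ-≤ k (ℤ.*-monoˡ-≤-nonNeg d {{ℤ.nonNegative 0≤d}} (-≤- ℕ.z≤n)) ⟩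
    d ℤ.* -1ℤ ℤ.+ k
      ≡⟨ cong (ℤ._+ k) (trans (ℤ.*-comm d -1ℤ) (ℤ.-1*i≡-i d)) ⟩
    ℤ.- d ℤ.+ k
      <⟨ ℤ.+-monoʳ-< (ℤ.- d) k<d ⟩
    ℤ.- d ℤ.+ d
      ≡⟨ ℤ.+-inverseˡ d ⟩
    0ℤ ∎

module ℤ[ω] (p q : ℤ) where
  open Quadratic ℤ.+-*-rawRing p q public
  open Walls ℤ.+-*-rawRing public

  norm-nonneg : 0ℤ ℤ.≤ disc → ∀ x → 0ℤ ℤ.≤ norm x
  norm-nonneg 0≤disc (x₀ , x₁) = ℤ.*-cancelʳ-≤-pos 0ℤ (norm (x₀ , x₁)) (+ 4)
    (subst (0ℤ ℤ.≤_) (sym (norm*4 p q x₀ x₁))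
      (ℤ.+-mono-≤ (0≤i*i (x₀ + x₀ + p * x₁)) (0≤i⇒0≤j⇒0≤i*j 0≤disc (0≤i*i x₁))))

  norm-pos : 0ℤ ℤ.< disc → ∀ {x} → x ≢ (0ℤ , 0ℤ) → 0ℤ ℤ.< norm x
  norm-pos 0<disc {x₀ , x₁} x≢0 with x₁ ℤ.≟ 0ℤ
  ... | yes refl = subst (0ℤ ℤ.<_) (sym (norm-rational p q x₀)) (0<i*i (x≢0 ∘ cong (_, 0ℤ)))
  ... | no x₁≢0  = ℤ.*-cancelʳ-<-nonNeg (+ 4)
    (subst (0ℤ ℤ.<_) (sym (norm*4 p q x₀ x₁))
      (ℤ.+-mono-≤-< (0≤i*i (x₀ + x₀ + p * x₁)) (0<i⇒0<j⇒0<i*j 0<disc (0<i*i x₁≢0))))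

  side-preserved : ∀ l a b c e → 0ℤ ℤ.≤ disc → norm l ℤ.< disc → a · e − b · c ≡ (1ℤ , 0ℤ) →
                   0ℤ ℤ.< side l a c → 0ℤ ℤ.≤ side l b e
  side-preserved l a b c e 0≤disc short det 0<X = 0≤d*[x*y]+k⇒0≤y 0≤disc short 0<X (begin
    0ℤ                                              ≤⟨ norm-nonneg 0≤disc h ⟩
    norm h                                          ≡⟨ norm-crossing p q l a b c e ⟩
    disc * (X * Y) + norm l * norm (a · e − b · c)  ≡⟨ cong (λ Δ → disc * (X * Y) + norm l * norm Δ) det ⟩
    disc * (X * Y) + norm l * norm (1ℤ , 0ℤ)        ≡⟨ cong (λ k → disc * (X * Y) + norm l * k) (norm-rational p q 1ℤ) ⟩
    disc * (X * Y) + norm l * 1ℤ                    ≡⟨ cong (λ k → disc * (X * Y) + k) (ℤ.*-identityʳ (norm l)) ⟩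
    disc * (X * Y) + norm l                         ∎)
    where
    open ℤ.≤-Reasoning
    h : ℤ × ℤ
    h = conj l · a · conj e − l · c · conj b
    X Y : ℤ
    X = side l a c
    Y = side l b e

  wall-preserved : ∀ W {a b c e} → 0ℤ ℤ.≤ disc → norm (direction W) ℤ.< disc → a · e − b · c ≡ (1ℤ , 0ℤ) →
                   lower W (a · conj c) (norm c) ℤ.< upper W (a · conj c) (norm c) →
                   lower W (b · conj e) (norm e) ℤ.≤ upper W (b · conj e) (norm e)
  wall-preserved W {a} {b} {c} {e} 0≤disc short det below =
    ℤ.0≤i-j⇒j≤i {upper W (b · conj e) (norm e)} (subst (0ℤ ℤ.≤_) (wall-side W p q b e) 0≤Y)
    where
    u = basepoint W
    0<X : 0ℤ ℤ.< side (direction W) (a − u · c) c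
    0<X = subst (0ℤ ℤ.<_) (sym (wall-side W p q a c)) (i<j⇒0<j-i below)
    0≤Y : 0ℤ ℤ.≤ side (direction W) (b − u · e) e
    0≤Y = side-preserved (direction W) (a − u · c) (b − u · e) c e 0≤disc short
            (trans (det-translate p q u a b c e) det) 0<X

toℚ : ℤ → ℚ
toℚ i = i / 1

mkℚ-int : ℤ → ℚ
mkℚ-int i = mkℚ i 0 (ℕ.sym (ℕ.1-coprimeTo ℤ.∣ i ∣))

toℚ≡mkℚ-int : ∀ i → toℚ i ≡ mkℚ-int i
toℚ≡mkℚ-int i = ℚ.↥p/↧p≡p (mkℚ-int i)

toℚ-injective : ∀ {i j} → toℚ i ≡ toℚ j → i ≡ j
toℚ-injective {i} {j} eq =
  trans (cong ℚ.↥_ (sym (toℚ≡mkℚ-int i))) (trans (cong ℚ.↥_ eq) (cong ℚ.↥_ (toℚ≡mkℚ-int j)))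

toℚ-+ : ∀ i j → toℚ (i ℤ.+ j) ≡ toℚ i ℚ.+ toℚ j
toℚ-+ i j = trans (cong toℚ (sym (cong₂ ℤ._+_ (ℤ.*-identityʳ i) (ℤ.*-identityʳ j))))
                  (sym (cong₂ ℚ._+_ (toℚ≡mkℚ-int i) (toℚ≡mkℚ-int j)))

toℚ-* : ∀ i j → toℚ (i ℤ.* j) ≡ toℚ i ℚ.* toℚ j
toℚ-* i j = sym (cong₂ ℚ._*_ (toℚ≡mkℚ-int i) (toℚ≡mkℚ-int j))

toℚ-neg : ∀ i → toℚ (ℤ.- i) ≡ ℚ.- toℚ i
toℚ-neg i = trans (toℚ≡mkℚ-int (ℤ.- i)) (trans (neg-mkℚ-int i) (cong ℚ.-_ (sym (toℚ≡mkℚ-int i))))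
  where
  neg-mkℚ-int : ∀ i → mkℚ-int (ℤ.- i) ≡ ℚ.- mkℚ-int i
  neg-mkℚ-int (+ 0)    = refl
  neg-mkℚ-int +[1+ n ] = refl
  neg-mkℚ-int -[1+ n ] = refl

toℚ-mono-≤ : ∀ {i j} → i ℤ.≤ j → toℚ i ℚ.≤ toℚ j
toℚ-mono-≤ {i} {j} i≤j = subst₂ ℚ._≤_ (sym (toℚ≡mkℚ-int i)) (sym (toℚ≡mkℚ-int j))
  (*≤* (subst₂ ℤ._≤_ (sym (ℤ.*-identityʳ i)) (sym (ℤ.*-identityʳ j)) i≤j))

toℚ-mono-< : ∀ {i j} → i ℤ.< j → toℚ i ℚ.< toℚ j
toℚ-mono-< {i} {j} i<j = subst₂ ℚ._<_ (sym (toℚ≡mkℚ-int i)) (sym (toℚ≡mkℚ-int j))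
  (*<* (subst₂ ℤ._<_ (sym (ℤ.*-identityʳ i)) (sym (ℤ.*-identityʳ j)) i<j))

toℚ-cancel-< : ∀ {i j} → toℚ i ℚ.< toℚ j → i ℤ.< j
toℚ-cancel-< {i} {j} lt with subst₂ ℚ._<_ (toℚ≡mkℚ-int i) (toℚ≡mkℚ-int j) lt
... | *<* i*1<j*1 = subst₂ ℤ._<_ (ℤ.*-identityʳ i) (ℤ.*-identityʳ j) i*1<j*1

ι-injective : ∀ {x y} → ι x ≡ ι y → x ≡ y
ι-injective eq = cong₂ _,_ (toℚ-injective (cong proj₁ eq)) (toℚ-injective (cong proj₂ eq))

module _ (p q : ℤ) where
  private
    module Z = Quadratic ℤ.+-*-rawRing p q
    module Q = Quadratic ℚ.+-*-rawRing (toℚ p) (toℚ q)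

  ι-· : ∀ x y → ι (x Z.· y) ≡ ι x Q.· ι y
  ι-· (x₀ , x₁) (y₀ , y₁) = cong₂ _,_
    (trans (toℚ-+ (x₀ ℤ.* y₀) (q ℤ.* (x₁ ℤ.* y₁)))
           (cong₂ ℚ._+_ (toℚ-* x₀ y₀) (trans (toℚ-* q (x₁ ℤ.* y₁)) (cong (toℚ q ℚ.*_) (toℚ-* x₁ y₁)))))
    (trans (toℚ-+ (x₀ ℤ.* y₁ ℤ.+ x₁ ℤ.* y₀) (p ℤ.* (x₁ ℤ.* y₁)))
           (cong₂ ℚ._+_ (trans (toℚ-+ (x₀ ℤ.* y₁) (x₁ ℤ.* y₀)) (cong₂ ℚ._+_ (toℚ-* x₀ y₁) (toℚ-* x₁ y₀)))
                        (trans (toℚ-* p (x₁ ℤ.* y₁)) (cong (toℚ p ℚ.*_) (toℚ-* x₁ y₁)))))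

  ι-− : ∀ x y → ι (x Z.− y) ≡ ι x Q.− ι y
  ι-− (x₀ , x₁) (y₀ , y₁) = cong₂ _,_
    (trans (toℚ-+ x₀ (ℤ.- y₀)) (cong (toℚ x₀ ℚ.+_) (toℚ-neg y₀)))
    (trans (toℚ-+ x₁ (ℤ.- y₁)) (cong (toℚ x₁ ℚ.+_) (toℚ-neg y₁)))

  ι-conj : ∀ x → ι (Z.conj x) ≡ Q.conj (ι x)
  ι-conj (x₀ , x₁) = cong₂ _,_ (trans (toℚ-+ x₀ (p ℤ.* x₁)) (cong (toℚ x₀ ℚ.+_) (toℚ-* p x₁))) (toℚ-neg x₁)

  toℚ-norm : ∀ x → toℚ (Z.norm x) ≡ Q.norm (ι x)
  toℚ-norm x = cong proj₁ (trans (ι-· x (Z.conj x)) (cong (ι x Q.·_) (ι-conj x)))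

pℤ qℤ : D → ℤ
pℤ d1  = 0ℤ
pℤ d2  = 0ℤ
pℤ d3  = 1ℤ
pℤ d7  = 1ℤ
pℤ d11 = 1ℤ
qℤ d1  = -[1+ 0 ]
qℤ d2  = -[1+ 1 ]
qℤ d3  = -[1+ 0 ]
qℤ d7  = -[1+ 1 ]
qℤ d11 = -[1+ 2 ]

module 𝒪 (d : D) = ℤ[ω] (pℤ d) (qℤ d)
module 𝕂 (d : D) = Quadratic ℚ.+-*-rawRing (toℚ (pℤ d)) (toℚ (qℤ d))
module ℚWalls = Walls ℚ.+-*-rawRing

kmul≡· : ∀ d x y → kmul d x y ≡ 𝕂._·_ d x y
kmul≡· d1  x y = refl
kmul≡· d2  x y = refl
kmul≡· d3  x y = refl
kmul≡· d7  x y = refl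
kmul≡· d11 x y = refl

0<disc : ∀ d → 0ℤ ℤ.< 𝒪.disc d
0<disc d1  = +<+ (ℕ.s≤s ℕ.z≤n)
0<disc d2  = +<+ (ℕ.s≤s ℕ.z≤n)
0<disc d3  = +<+ (ℕ.s≤s ℕ.z≤n)
0<disc d7  = +<+ (ℕ.s≤s ℕ.z≤n)
0<disc d11 = +<+ (ℕ.s≤s ℕ.z≤n)

det≡1 : ∀ {d} (A : SL2 d) → let open 𝒪 d in a A · e A − b A · c A ≡ (1ℤ , 0ℤ)
det≡1 {d} (mat a b c e det) = ι-injective (begin
  ι (a · e − b · c)                                      ≡⟨ ι-− p q (a · e) (b · c) ⟩
  ι (a · e) K.− ι (b · c)                                ≡⟨ cong₂ K._−_ (ι-· p q a e) (ι-· p q b c) ⟩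
  ι a K.· ι e K.− ι b K.· ι c
    ≡⟨ cong₂ K._−_ (kmul≡· d (ι a) (ι e)) (kmul≡· d (ι b) (ι c)) ⟨
  kadd (kmul d (ι a) (ι e)) (kneg (kmul d (ι b) (ι c)))  ≡⟨ det ⟩
  kone                                                   ∎)
  where
  open ≡-Reasoning
  open 𝒪 d
  module K = 𝕂 d
  p = pℤ d
  q = qℤ d

module Fraction {d : D} {z : K} (a c : Zω) (z≡a/c : _≈quot_/_ {d} (fin z) a c) where
  open 𝒪 d
  private
    module K = 𝕂 d
    p = pℤ d
    q = qℤ d

  0<norm[c] : 0ℤ ℤ.< norm c
  0<norm[c] = norm-pos (0<disc d) {c} (proj₁ z≡a/c ∘ cong ι)

  scale : ℚ
  scale = toℚ (norm c)

  0<scale : 0ℚ ℚ.< scale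
  0<scale = toℚ-mono-< 0<norm[c]

  homogeneous-coordinates : ι (a · conj c) ≡ (proj₁ z ℚ.* scale , proj₂ z ℚ.* scale)
  homogeneous-coordinates = begin
    ι (a · conj c)                                         ≡⟨ ι-· p q a (conj c) ⟩
    ι a K.· ι (conj c)                                     ≡⟨ cong₂ K._·_ a≡c·z (ι-conj p q c) ⟩
    ι c K.· z K.· K.conj (ι c)                             ≡⟨ ·-conj-norm (toℚ p) (toℚ q) (ι c) z ⟩
    (proj₁ z ℚ.* K.norm (ι c) , proj₂ z ℚ.* K.norm (ι c))
      ≡⟨ cong (λ N → proj₁ z ℚ.* N , proj₂ z ℚ.* N) (toℚ-norm p q c) ⟨
    (proj₁ z ℚ.* scale , proj₂ z ℚ.* scale)                ∎
    where
    open ≡-Reasoning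
    a≡c·z : ι a ≡ ι c K.· z
    a≡c·z = trans (sym (proj₂ z≡a/c)) (kmul≡· d (ι c) z)

  lower-scaled : ∀ W → toℚ (lower W (a · conj c) (norm c)) ≡ ℚWalls.lower W z 1ℚ ℚ.* scale
  lower-scaled left     = sym (ℚ.*-zeroˡ scale)
  lower-scaled bottom   = sym (ℚ.*-zeroˡ scale)
  lower-scaled right    = cong proj₁ homogeneous-coordinates
  lower-scaled top      = cong proj₂ homogeneous-coordinates
  lower-scaled diagonal = begin
    toℚ (proj₁ (a · conj c) ℤ.+ proj₂ (a · conj c))           ≡⟨ toℚ-+ (proj₁ (a · conj c)) (proj₂ (a · conj c)) ⟩
    toℚ (proj₁ (a · conj c)) ℚ.+ toℚ (proj₂ (a · conj c))     ≡⟨ cong₂ ℚ._+_ (cong proj₁ homogeneous-coordinates)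
                                                                             (cong proj₂ homogeneous-coordinates) ⟩
    proj₁ z ℚ.* scale ℚ.+ proj₂ z ℚ.* scale                   ≡⟨ ℚ.*-distribʳ-+ scale (proj₁ z) (proj₂ z) ⟨
    (proj₁ z ℚ.+ proj₂ z) ℚ.* scale                           ∎
    where open ≡-Reasoning

  upper-scaled : ∀ W → toℚ (upper W (a · conj c) (norm c)) ≡ ℚWalls.upper W z 1ℚ ℚ.* scale
  upper-scaled left     = cong proj₁ homogeneous-coordinates
  upper-scaled bottom   = cong proj₂ homogeneous-coordinates
  upper-scaled right    = sym (ℚ.*-identityˡ scale)
  upper-scaled top      = sym (ℚ.*-identityˡ scale)
  upper-scaled diagonal = sym (ℚ.*-identityˡ scale)

  homogenise-< : ∀ W → ℚWalls.lower W z 1ℚ ℚ.< ℚWalls.upper W z 1ℚ →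
                 lower W (a · conj c) (norm c) ℤ.< upper W (a · conj c) (norm c)
  homogenise-< W lt = toℚ-cancel-< (subst₂ ℚ._<_ (sym (lower-scaled W)) (sym (upper-scaled W))
    (ℚ.*-monoˡ-<-pos scale {{ℚ.positive 0<scale}} lt))

  dehomogenise-≤ : ∀ W → lower W (a · conj c) (norm c) ℤ.≤ upper W (a · conj c) (norm c) →
                   ℚWalls.lower W z 1ℚ ℚ.≤ ℚWalls.upper W z 1ℚ
  dehomogenise-≤ W le = ℚ.*-cancelʳ-≤-pos scale {{ℚ.positive 0<scale}}
    (subst₂ ℚ._≤_ (lower-scaled W) (upper-scaled W) (toℚ-mono-≤ le))

module FiniteEdge {d : D} {z w : K} (edge : Edge d (fin z) (fin w)) where
  open 𝒪 d
  private
    A = proj₁ edge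
    module Z = Fraction {d} (a A) (c A) (proj₁ (proj₂ edge))
    module W = Fraction {d} (b A) (e A) (proj₂ (proj₂ edge))

  -- short is solved by evaluation wherever d and W are concrete.
  wall-respected : ∀ W {short : True (norm (direction W) ℤ.<? disc)} →
                   ℚWalls.lower W z 1ℚ ℚ.< ℚWalls.upper W z 1ℚ → ℚWalls.lower W w 1ℚ ℚ.≤ ℚWalls.upper W w 1ℚ
  wall-respected W {short} = W.dehomogenise-≤ W
                           ∘ wall-preserved W {a A} {b A} {c A} {e A} (ℤ.<⇒≤ (0<disc d)) (toWitness short) (det≡1 A)
                           ∘ Z.homogenise-< W

module InfiniteEdge {d : D} {z : K} (edge : Edge d (fin z) ∞) where
  open 𝒪 d
  private
    A = proj₁ edge
  open Fraction {d} (a A) (c A) (proj₁ (proj₂ edge)) public using (homogenise-<; 0<norm[c])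

  norm[c]≡1 : norm (c A) ≡ 1ℤ
  norm[c]≡1 = 0≤i⇒0<j⇒i*j≡1⇒j≡1 (norm-nonneg (ℤ.<⇒≤ (0<disc d)) (b A)) 0<norm[c] (begin
    norm (b A) * norm (c A)             ≡⟨ norm-antidiagonal-det (pℤ d) (qℤ d) (a A) (b A) (c A) ⟨
    norm (a A · (0ℤ , 0ℤ) − b A · c A)  ≡⟨ cong (λ e → norm (a A · e − b A · c A)) e≡0 ⟨
    norm (a A · e A − b A · c A)        ≡⟨ cong norm (det≡1 A) ⟩
    norm (1ℤ , 0ℤ)                      ≡⟨ norm-rational (pℤ d) (qℤ d) 1ℤ ⟩
    1ℤ                                  ∎)
    where
    open ≡-Reasoning
    e≡0 : e A ≡ (0ℤ , 0ℤ)
    e≡0 = ι-injective (proj₂ (proj₂ edge))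

  no-lattice-point : ∀ {i} → 0ℤ ℤ.< i → i ℤ.< norm (c A) → ⊥
  no-lattice-point 0<i i<N = ℤ.<⇒≱ (subst (_ ℤ.<_) norm[c]≡1 i<N) (ℤ.i<j⇒suc[i]≤j 0<i)

  no-lattice-point-in-triangle : ∀ {i j} → 0ℤ ℤ.< i → 0ℤ ℤ.< j → i ℤ.+ j ℤ.< norm (c A) → ⊥
  no-lattice-point-in-triangle {i} 0<i 0<j i+j<N =
    no-lattice-point 0<i (ℤ.<-trans (subst (ℤ._< i ℤ.+ _) (ℤ.+-identityʳ i) (ℤ.+-monoʳ-< i 0<j)) i+j<N)

edge-into-W : ∀ d {z w} → Edge d (fin z) (fin w) → inWopen d z → inWclosed d w
edge-into-W d1 E ((0<s , s<1) , (0<t , t<1)) =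
  (wall-respected left 0<s , wall-respected right s<1) , (wall-respected bottom 0<t , wall-respected top t<1)
  where open FiniteEdge E
edge-into-W d2 E ((0<s , s<1) , (0<t , t<1)) =
  (wall-respected left 0<s , wall-respected right s<1) , (wall-respected bottom 0<t , wall-respected top t<1)
  where open FiniteEdge E
edge-into-W d3 E (0<s , 0<t , s+t<1) =
  wall-respected left 0<s , wall-respected bottom 0<t , wall-respected diagonal s+t<1
  where open FiniteEdge E
edge-into-W d7 E (0<s , 0<t , s+t<1) =
  wall-respected left 0<s , wall-respected bottom 0<t , wall-respected diagonal s+t<1
  where open FiniteEdge E
edge-into-W d11 E (0<s , 0<t , s+t<1) =
  wall-respected left 0<s , wall-respected bottom 0<t , wall-respected diagonal s+t<1
  where open FiniteEdge E

no-edge-to-∞ : ∀ d {z} → Edge d (fin z) ∞ → ¬ inWopen d z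
no-edge-to-∞ d1 E ((0<s , s<1) , _) =
  no-lattice-point (homogenise-< left 0<s) (homogenise-< right s<1)
  where open InfiniteEdge E
no-edge-to-∞ d2 E ((0<s , s<1) , _) =
  no-lattice-point (homogenise-< left 0<s) (homogenise-< right s<1)
  where open InfiniteEdge E
no-edge-to-∞ d3 E (0<s , 0<t , s+t<1) =
  no-lattice-point-in-triangle (homogenise-< left 0<s) (homogenise-< bottom 0<t) (homogenise-< diagonal s+t<1)
  where open InfiniteEdge E
no-edge-to-∞ d7 E (0<s , 0<t , s+t<1) =
  no-lattice-point-in-triangle (homogenise-< left 0<s) (homogenise-< bottom 0<t) (homogenise-< diagonal s+t<1)
  where open InfiniteEdge E
no-edge-to-∞ d11 E (0<s , 0<t , s+t<1) =
  no-lattice-point-in-triangle (homogenise-< left 0<s) (homogenise-< bottom 0<t) (homogenise-< diagonal s+t<1)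
  where open InfiniteEdge E

corollary1 : (d : D) (R₁ R₂ : Vertex) → Edge d R₁ R₂ → InInterior d R₁ → InClosure d R₂
corollary1 d ∞       _       _    ()
corollary1 d (fin z) ∞       edge z° = no-edge-to-∞ d edge z°
corollary1 d (fin z) (fin w) edge z° = edge-into-W d edge z°
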